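{- Any two assorted and reduced central terms of the same type are equal.
   Context: Formulae are built from an infinite set of propositional letters and a constant $I$ using binary connectives $\otimes$ and $\to$. An $\alpha$-formula is a formula considered up to strict associativity of $\otimes$ and strict unitality of $I$ ($A\otimes(B\otimes C)=(A\otimes B)\otimes C$, $A\otimes I=I\otimes A=A$, also inside subformulae). An $\alpha$-formula is prime if it is not of the form $A\otimes B$ with $A,B$ both different from $I$; every $\alpha$-formula is uniquely $A_1\otimes\dots\otimes A_n$ with $A_i$ prime, its prime factors. An $\alpha$-formula is constant if it contains no letters; it is assorted if all its non-constant prime factors are mutually distinct. Terms with types $f\colon A\vdash B$: primitive $\mathbf 1_A\colon A\vdash A$, $c_{B,A}\colon B\otimes A\vdash A\otimes B$, $\eta_{A,B}\colon B\vdash A\to(A\otimes B)$, $\varepsilon_{A,B}\colon A\otimes(A\to B)\vdash B$; closed under $g\circ f$, $f_1\otimes f_2$, and $A\to f\colon A\to B_1\vdash A\to B_2$ (for $f\colon B_1\vdash B_2$); strictly $f\otimes(g\otimes h)=(f\otimes g)\otimes h$, $f\otimes\mathbf 1_I=\mathbf 1_I\otimes f=f$. Equality of terms is the smallest congruence (only between terms of the same type) containing: $g\circ\mathbf 1_A=g$, $\mathbf 1_A\circ f=f$; $h\circ(g\circ f)=(h\circ g)\circ f$; $\mathbf 1_A\otimes\mathbf 1_B=\mathbf 1_{A\otimes B}$; $(g_1\otimes g_2)\circ(f_1\otimes f_2)=(g_1\circ f_1)\otimes(g_2\circ f_2)$; $c_{A',B'}\circ(f\otimes g)=(g\otimes f)\circ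 c_{A,B}$ ($f\colon A\vdash A'$, $g\colon B\vdash B'$); $c_{B,A}\circ c_{A,B}=\mathbf 1_{A\otimes B}$; $c_{A\otimes B,C}=(c_{A,C}\otimes\mathbf 1_B)\circ(\mathbf 1_A\otimes c_{B,C})$; $A\to(g\circ f)=(A\to g)\circ(A\to f)$; $\eta_{A,B'}\circ f=(A\to(\mathbf 1_A\otimes f))\circ\eta_{A,B}$; $A\to\mathbf 1_B=\mathbf 1_{A\to B}$; $\varepsilon_{A,B'}\circ(\mathbf 1_A\otimes(A\to f))=f\circ\varepsilon_{A,B}$; $\varepsilon_{A,A\otimes B}\circ(\mathbf 1_A\otimes\eta_{A,B})=\mathbf 1_{A\otimes B}$; $(A\to\varepsilon_{A,B})\circ\eta_{A,A\to B}=\mathbf 1_{A\to B}$. A term is central if it contains no $\eta$, no $\varepsilon$ and no use of the operation $A\to(\cdot)$. For a central term $f\colon A\vdash B$: $f$ is non-constant central if $A$ (equivalently $B$) has no constant prime factors; $f$ is $I$-central if $A$ (equivalently $B$) is $I$; $f$ is assorted if $A$ (equivalently $B$) is assorted; $f$ is reduced if it is non-constant central or $I$-central. -}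

module Defs where

open import Data.Nat using (ℕ)
open import Data.List using (List; []; _∷_; [_]; _++_; length; lookup)
open import Data.List.Relation.Unary.All using (All)
open import Data.Fin using (Fin)
open import Data.Product using (_×_; Σ)
open import Data.Sum using (_⊎_)
open import Data.Unit using (⊤)
open import Data.Empty using (⊥)
open import Relation.Nullary using (¬_)
open import Relation.Binary.PropositionalEquality using (_≡_; _≢_; refl; sym; subst₂)
open import Data.List.Properties using (++-assoc)

-- An α-formula is the list of its prime factors (I = [], ⊗ = _++_),
-- which builds in strict associativity and unitality of ⊗ and I,
-- also inside subformulae.

mutual
  data Prime : Set where
    var : ℕ → Prime
    _⇒_ : Form → Form → Prime

  Form : Set
  Form = List Prime

I : Form
I = []

_⊗F_ : Form → Form → Form
A ⊗F B = A ++ B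

_⟶_ : Form → Form → Form
A ⟶ B = [ A ⇒ B ]

mutual
  ConstP : Prime → Set
  ConstP (var _) = ⊥
  ConstP (A ⇒ B) = ConstF A × ConstF B

  ConstF : Form → Set
  ConstF []       = ⊤
  ConstF (p ∷ ps) = ConstP p × ConstF ps

Assorted : Form → Set
Assorted A = (i j : Fin (length A)) → i ≢ j →
  ¬ ConstP (lookup A i) → ¬ ConstP (lookup A j) → lookup A i ≢ lookup A j

data Tm : Form → Form → Set where
  id  : (A : Form) → Tm A A
  c   : (B A : Form) → Tm (B ++ A) (A ++ B)
  η   : (A B : Form) → Tm B (A ⟶ (A ++ B))
  ε   : (A B : Form) → Tm (A ++ (A ⟶ B)) B
  _∘_ : ∀ {A B C} → Tm B C → Tm A B → Tm A C
  _⊗_ : ∀ {A₁ B₁ A₂ B₂} → Tm A₁ B₁ → Tm A₂ B₂ → Tm (A₁ ++ A₂) (B₁ ++ B₂)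
  arr : ∀ {B₁ B₂} (A : Form) → Tm B₁ B₂ → Tm (A ⟶ B₁) (A ⟶ B₂)

castTm : ∀ {A A' B B'} → A ≡ A' → B ≡ B' → Tm A B → Tm A' B'
castTm p q f = subst₂ Tm p q f

-- Terms are taken up to strict associativity of ⊗
-- and strict unitality of 1_I; these identifications are added as rules,
-- and the relation is stated heterogeneously in the indices, since the
-- indices of strictly identified terms are only propositionally equal
-- (e.g. A ++ (B ++ C) vs (A ++ B) ++ C).  Every rule relates terms whose
-- types are equal α-formulae.

infix 4 _≈_
data _≈_ : ∀ {A B A' B'} → Tm A B → Tm A' B' → Set where
  ≈-refl  : ∀ {A B} {f : Tm A B} → f ≈ f
  ≈-sym   : ∀ {A B A' B'} {f : Tm A B} {g : Tm A' B'} → f ≈ g → g ≈ f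
  ≈-trans : ∀ {A B A' B' A'' B''} {f : Tm A B} {g : Tm A' B'} {h : Tm A'' B''} →
            f ≈ g → g ≈ h → f ≈ h
  ∘-cong  : ∀ {A B C A' B' C'} {g : Tm B C} {f : Tm A B} {g' : Tm B' C'} {f' : Tm A' B'} →
            g ≈ g' → f ≈ f' → (g ∘ f) ≈ (g' ∘ f')
  ⊗-cong  : ∀ {A₁ B₁ A₂ B₂ A₁' B₁' A₂' B₂'}
              {f₁ : Tm A₁ B₁} {f₂ : Tm A₂ B₂} {f₁' : Tm A₁' B₁'} {f₂' : Tm A₂' B₂'} →
            f₁ ≈ f₁' → f₂ ≈ f₂' → (f₁ ⊗ f₂) ≈ (f₁' ⊗ f₂')
  arr-cong : ∀ (A : Form) {B₁ B₂ B₁' B₂'} {f : Tm B₁ B₂} {f' : Tm B₁' B₂'} →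
            f ≈ f' → arr A f ≈ arr A f'
  cast-≈  : ∀ {A A' B B'} (p : A ≡ A') (q : B ≡ B') (f : Tm A B) → castTm p q f ≈ f
  ⊗-assoc : ∀ {A₁ B₁ A₂ B₂ A₃ B₃} (f : Tm A₁ B₁) (g : Tm A₂ B₂) (h : Tm A₃ B₃) →
            (f ⊗ (g ⊗ h)) ≈ ((f ⊗ g) ⊗ h)
  ⊗-unitʳ : ∀ {A B} (f : Tm A B) → (f ⊗ id I) ≈ f
  ⊗-unitˡ : ∀ {A B} (f : Tm A B) → (id I ⊗ f) ≈ f
  idʳ     : ∀ {A B} (g : Tm A B) → (g ∘ id A) ≈ g
  idˡ     : ∀ {A B} (f : Tm A B) → (id B ∘ f) ≈ f
  ∘-assoc : ∀ {A B C D} (h : Tm C D) (g : Tm B C) (f : Tm A B) →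
            (h ∘ (g ∘ f)) ≈ ((h ∘ g) ∘ f)
  id⊗id   : ∀ (A B : Form) → (id A ⊗ id B) ≈ id (A ++ B)
  interchange : ∀ {A₁ B₁ C₁ A₂ B₂ C₂}
              (g₁ : Tm B₁ C₁) (g₂ : Tm B₂ C₂) (f₁ : Tm A₁ B₁) (f₂ : Tm A₂ B₂) →
            ((g₁ ⊗ g₂) ∘ (f₁ ⊗ f₂)) ≈ ((g₁ ∘ f₁) ⊗ (g₂ ∘ f₂))
  c-nat   : ∀ {A A' B B'} (f : Tm A A') (g : Tm B B') →
            (c A' B' ∘ (f ⊗ g)) ≈ ((g ⊗ f) ∘ c A B)
  c-inv   : ∀ (A B : Form) → (c B A ∘ c A B) ≈ id (A ++ B)
  c-hex   : ∀ (A B C : Form) →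
            c (A ++ B) C ≈ ((c A C ⊗ id B) ∘ castTm refl (sym (++-assoc A C B)) (id A ⊗ c B C))
  arr-∘   : ∀ (A : Form) {B₁ B₂ B₃} (g : Tm B₂ B₃) (f : Tm B₁ B₂) →
            arr A (g ∘ f) ≈ (arr A g ∘ arr A f)
  η-nat   : ∀ (A : Form) {B B'} (f : Tm B B') →
            (η A B' ∘ f) ≈ (arr A (id A ⊗ f) ∘ η A B)
  arr-id  : ∀ (A B : Form) → arr A (id B) ≈ id (A ⟶ B)
  ε-nat   : ∀ (A : Form) {B B'} (f : Tm B B') →
            (ε A B' ∘ (id A ⊗ arr A f)) ≈ (f ∘ ε A B)
  εη      : ∀ (A B : Form) → (ε A (A ++ B) ∘ (id A ⊗ η A B)) ≈ id (A ++ B)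
  ηε      : ∀ (A B : Form) → (arr A (ε A B) ∘ η A (A ⟶ B)) ≈ id (A ⟶ B)

data Central : ∀ {A B} → Tm A B → Set where
  id  : (A : Form) → Central (id A)
  c   : (B A : Form) → Central (c B A)
  _∘_ : ∀ {A B C} {g : Tm B C} {f : Tm A B} → Central g → Central f → Central (g ∘ f)
  _⊗_ : ∀ {A₁ B₁ A₂ B₂} {f : Tm A₁ B₁} {g : Tm A₂ B₂} →
        Central f → Central g → Central (f ⊗ g)

NonConstCentral : ∀ {A B} → Tm A B → Set
NonConstCentral {A} f = Central f × All (λ p → ¬ ConstP p) A

ICentral : ∀ {A B} → Tm A B → Set
ICentral {A} f = Central f × A ≡ I

AssortedTm : ∀ {A B} → Tm A B → Set
AssortedTm {A} f = Central f × Assorted A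

Reduced : ∀ {A B} → Tm A B → Set
Reduced f = NonConstCentral f ⊎ ICentral f

{-# OPTIONS --safe #-}
module Submission where

-- A central term is built from symmetries, so by the hexagon and naturality it equals a
-- word of adjacent transpositions of prime factors.  If the source factors are pairwise
-- distinct, the position of the first factor a in the target is determined, and the braid
-- relation rewrites every word as a word on the other factors followed by moving a into
-- place; induction on the number of factors then identifies any two words.  An assorted
-- reduced source has distinct factors: either none of them is constant, or the source is I.

open import Defs
open import Data.List using ([]; _∷_; [_]; _++_; lookup)
open import Data.List.Properties using (++-assoc; ++-identityʳ; ∷-injective)
open import Data.List.Membership.Propositional using (_∈_)
open import Data.List.Membership.Propositional.Properties using (∈-insert)
open import Data.List.Relation.Unary.All as All using (All; []; _∷_)
open import Data.List.Relation.Unary.AllPairs using ([]; _∷_)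
open import Data.List.Relation.Unary.Any using (index)
open import Data.List.Relation.Unary.Any.Properties using (lookup-index)
open import Data.List.Relation.Unary.Unique.Propositional using (Unique)
open import Data.List.Relation.Unary.Unique.Propositional.Properties using (Unique[x∷xs]⇒x∉xs)
open import Data.List.Relation.Binary.Permutation.Propositional using (_↭_; ↭-refl; ↭-prep; ↭-swap; ↭-trans; ↭⇒↭ₛ)
open import Relation.Binary.PropositionalEquality.Properties using (setoid)
open import Data.List.Relation.Binary.Permutation.Setoid.Properties (setoid Prime) using (Unique-resp-↭)
open import Data.Fin using (zero; suc)
open import Data.Fin.Properties using (suc-injective)
open import Data.Product using (Σ-syntax; _×_; _,_; map₁)
open import Data.Sum using (inj₁; inj₂)
open import Data.Empty using (⊥-elim)
open import Relation.Nullary using (¬_)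
open import Relation.Binary.PropositionalEquality using (_≡_; _≢_; refl; sym; trans; cong; subst)

infixr 1 _⟫_
_⟫_ : ∀ {A B A' B' A'' B''} {f : Tm A B} {g : Tm A' B'} {h : Tm A'' B''} →
      f ≈ g → g ≈ h → f ≈ h
_⟫_ = ≈-trans

module ≈-Reasoning where
  infix  1 begin_
  infixr 2 _≈⟨_⟩_
  infix  3 _∎

  begin_ : ∀ {A B A' B'} {f : Tm A B} {g : Tm A' B'} → f ≈ g → f ≈ g
  begin p = p

  _≈⟨_⟩_ : ∀ {A B A' B' A'' B''} (f : Tm A B) {g : Tm A' B'} {h : Tm A'' B''} →
           f ≈ g → g ≈ h → f ≈ h
  _ ≈⟨ p ⟩ q = ≈-trans p q

  _∎ : ∀ {A B} (f : Tm A B) → f ≈ f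
  _ ∎ = ≈-refl

open ≈-Reasoning

id⊗-∘ : ∀ X {A B C} (g : Tm B C) (f : Tm A B) →
        (id X ⊗ (g ∘ f)) ≈ ((id X ⊗ g) ∘ (id X ⊗ f))
id⊗-∘ X g f = ⊗-cong (≈-sym (idˡ (id X))) ≈-refl ⟫ ≈-sym (interchange (id X) g (id X) f)

∘-⊗id : ∀ Z {A B C} (g : Tm B C) (f : Tm A B) →
        ((g ∘ f) ⊗ id Z) ≈ ((g ⊗ id Z) ∘ (f ⊗ id Z))
∘-⊗id Z g f = ⊗-cong ≈-refl (≈-sym (idˡ (id Z))) ⟫ ≈-sym (interchange g (id Z) f (id Z))

id⊗-id⊗ : ∀ X Y {A B} (f : Tm A B) → (id X ⊗ (id Y ⊗ f)) ≈ (id (X ++ Y) ⊗ f)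
id⊗-id⊗ X Y f = ⊗-assoc (id X) (id Y) f ⟫ ⊗-cong (id⊗id X Y) ≈-refl

⊗id-⊗id : ∀ {A B} (f : Tm A B) X Z → ((f ⊗ id X) ⊗ id Z) ≈ (f ⊗ id (X ++ Z))
⊗id-⊗id f X Z = ≈-sym (⊗-assoc f (id X) (id Z)) ⟫ ⊗-cong ≈-refl (id⊗id X Z)

⊗-as-∘ˡ : ∀ {A₁ B₁ A₂ B₂} (f : Tm A₁ B₁) (g : Tm A₂ B₂) →
          (f ⊗ g) ≈ ((id B₁ ⊗ g) ∘ (f ⊗ id A₂))
⊗-as-∘ˡ {B₁ = B₁} {A₂ = A₂} f g =
  ⊗-cong (≈-sym (idˡ f)) (≈-sym (idʳ g)) ⟫ ≈-sym (interchange (id B₁) g f (id A₂))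

⊗-as-∘ʳ : ∀ {A₁ B₁ A₂ B₂} (f : Tm A₁ B₁) (g : Tm A₂ B₂) →
          (f ⊗ g) ≈ ((f ⊗ id B₂) ∘ (id A₁ ⊗ g))
⊗-as-∘ʳ {A₁ = A₁} {B₂ = B₂} f g =
  ⊗-cong (≈-sym (idʳ f)) (≈-sym (idˡ g)) ⟫ ≈-sym (interchange f (id B₂) (id A₁) g)

⊗-slide : ∀ {X Y Z Z'} (f : Tm X Y) (h : Tm Z Z') →
          ((f ⊗ id Z') ∘ (id X ⊗ h)) ≈ ((id Y ⊗ h) ∘ (f ⊗ id Z))
⊗-slide f h = ≈-sym (⊗-as-∘ʳ f h) ⟫ ⊗-as-∘ˡ f h

c-slide : ∀ a x {Z Z'} (h : Tm Z Z') →
          ((c [ a ] [ x ] ⊗ id Z') ∘ (id [ a ] ⊗ (id [ x ] ⊗ h)))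
          ≈ ((id [ x ] ⊗ (id [ a ] ⊗ h)) ∘ (c [ a ] [ x ] ⊗ id Z))
c-slide a x h =
  ∘-cong ≈-refl (id⊗-id⊗ [ a ] [ x ] h) ⟫ ⊗-slide (c [ a ] [ x ]) h ⟫
  ∘-cong (≈-sym (id⊗-id⊗ [ x ] [ a ] h)) ≈-refl

left-inverse≈right-inverse : ∀ {A B} {k r : Tm A B} (h : Tm B A) →
                 (k ∘ h) ≈ id B → (h ∘ r) ≈ id A → k ≈ r
left-inverse≈right-inverse {k = k} {r} h kh≈id hr≈id =
  ≈-sym (idʳ k) ⟫ ∘-cong ≈-refl (≈-sym hr≈id) ⟫ ∘-assoc k h r ⟫ ∘-cong kh≈id ≈-refl ⟫ idˡ r

idempotent-retraction≈id : ∀ {A} {e d : Tm A A} →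
                           e ≈ (e ∘ e) → (d ∘ e) ≈ id A → e ≈ id A
idempotent-retraction≈id {e = e} {d} ee≈e de≈id =
  ≈-sym (idˡ e) ⟫ ∘-cong (≈-sym de≈id) ≈-refl ⟫ ≈-sym (∘-assoc d e e) ⟫
  ∘-cong ≈-refl (≈-sym ee≈e) ⟫ de≈id

-- c I Y is idempotent by the hexagon with A = B = I, and invertible.
c-unitˡ : ∀ Y → c I Y ≈ id Y
c-unitˡ Y = ≈-sym (cast-≈ refl Y≡Y++I e) ⟫ idempotent-retraction≈id e₀-idempotent d₀e₀≈id
  where
  Y≡Y++I : Y ++ I ≡ Y
  Y≡Y++I = ++-identityʳ Y
  e : Tm Y (Y ++ I)
  e = c I Y
  e₀ : Tm Y Y
  e₀ = castTm refl Y≡Y++I e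
  e₀-idempotent : e₀ ≈ (e₀ ∘ e₀)
  e₀-idempotent =
    cast-≈ refl Y≡Y++I e ⟫ c-hex I I Y ⟫
    ∘-cong (⊗-unitʳ e ⟫ ≈-sym (cast-≈ refl Y≡Y++I e)) (⊗-unitˡ e ⟫ ≈-sym (cast-≈ refl Y≡Y++I e))
  d₀e₀≈id : (castTm Y≡Y++I refl (c Y I) ∘ e₀) ≈ id Y
  d₀e₀≈id = ∘-cong (cast-≈ Y≡Y++I refl (c Y I)) (cast-≈ refl Y≡Y++I e) ⟫ c-inv I Y

c-unitʳ : ∀ X → c X I ≈ id (X ++ I)
c-unitʳ X = ≈-sym (idˡ (c X I)) ⟫ ∘-cong (≈-sym (c-unitˡ X)) ≈-refl ⟫ c-inv X I

c-hexʳ : ∀ x y Y → c [ x ] (y ∷ Y) ≈ ((id [ y ] ⊗ c [ x ] Y) ∘ (c [ x ] [ y ] ⊗ id Y))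
c-hexʳ x y Y = left-inverse≈right-inverse (c (y ∷ Y) [ x ]) (c-inv (y ∷ Y) [ x ]) (begin
    c (y ∷ Y) [ x ] ∘ ((id [ y ] ⊗ c [ x ] Y) ∘ (c [ x ] [ y ] ⊗ id Y))
  ≈⟨ ∘-cong (c-hex [ y ] Y [ x ]) ≈-refl ⟫ ≈-sym (∘-assoc _ _ _) ⟫
     ∘-cong ≈-refl (∘-assoc _ _ _) ⟩
    (c [ y ] [ x ] ⊗ id Y) ∘ (((id [ y ] ⊗ c Y [ x ]) ∘ (id [ y ] ⊗ c [ x ] Y)) ∘ (c [ x ] [ y ] ⊗ id Y))
  ≈⟨ ∘-cong ≈-refl (∘-cong (≈-sym (id⊗-∘ [ y ] _ _) ⟫ ⊗-cong ≈-refl (c-inv [ x ] Y) ⟫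
                            id⊗id [ y ] (x ∷ Y)) ≈-refl ⟫
                    idˡ _) ⟩
    (c [ y ] [ x ] ⊗ id Y) ∘ (c [ x ] [ y ] ⊗ id Y)
  ≈⟨ ≈-sym (∘-⊗id Y _ _) ⟫ ⊗-cong (c-inv [ x ] [ y ]) ≈-refl ⟫ id⊗id (x ∷ y ∷ []) Y ⟩
    id (x ∷ y ∷ Y) ∎)

c-braid : ∀ a p q →
  ((c [ p ] [ q ] ⊗ id [ a ]) ∘ ((id [ p ] ⊗ c [ a ] [ q ]) ∘ (c [ a ] [ p ] ⊗ id [ q ])))
  ≈ ((id [ q ] ⊗ c [ a ] [ p ]) ∘ ((c [ a ] [ q ] ⊗ id [ p ]) ∘ (id [ a ] ⊗ c [ p ] [ q ])))
c-braid a p q = begin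
    (c [ p ] [ q ] ⊗ id [ a ]) ∘ ((id [ p ] ⊗ c [ a ] [ q ]) ∘ (c [ a ] [ p ] ⊗ id [ q ]))
  ≈⟨ ∘-assoc _ _ _ ⟫ ∘-cong (≈-sym (c-hex [ p ] [ a ] [ q ])) ≈-refl ⟩
    c (p ∷ a ∷ []) [ q ] ∘ (c [ a ] [ p ] ⊗ id [ q ])
  ≈⟨ c-nat (c [ a ] [ p ]) (id [ q ]) ⟩
    (id [ q ] ⊗ c [ a ] [ p ]) ∘ c (a ∷ p ∷ []) [ q ]
  ≈⟨ ∘-cong ≈-refl (c-hex [ a ] [ p ] [ q ]) ⟩
    (id [ q ] ⊗ c [ a ] [ p ]) ∘ ((c [ a ] [ q ] ⊗ id [ p ]) ∘ (id [ a ] ⊗ c [ p ] [ q ])) ∎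

c-braid-⊗id : ∀ a p q Z →
  ((c [ p ] [ q ] ⊗ id (a ∷ Z)) ∘ ((id [ p ] ⊗ (c [ a ] [ q ] ⊗ id Z)) ∘ (c [ a ] [ p ] ⊗ id (q ∷ Z))))
  ≈ ((id [ q ] ⊗ (c [ a ] [ p ] ⊗ id Z)) ∘ ((c [ a ] [ q ] ⊗ id (p ∷ Z)) ∘ (id [ a ] ⊗ (c [ p ] [ q ] ⊗ id Z))))
c-braid-⊗id a p q Z =
  ≈-sym (∘-cong (⊗id-⊗id _ [ a ] Z) (∘-cong (≈-sym (⊗-assoc _ _ _)) (⊗id-⊗id _ [ q ] Z))) ⟫
  ≈-sym (∘-⊗id Z _ _ ⟫ ∘-cong ≈-refl (∘-⊗id Z _ _)) ⟫
  ⊗-cong (c-braid a p q) ≈-refl ⟫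
  ∘-⊗id Z _ _ ⟫ ∘-cong ≈-refl (∘-⊗id Z _ _) ⟫
  ∘-cong (≈-sym (⊗-assoc _ _ _)) (∘-cong (⊗id-⊗id _ [ p ] Z) (≈-sym (⊗-assoc _ _ _)))

data Swap : Form → Form → Set where
  here  : ∀ {p q Y} → Swap (p ∷ q ∷ Y) (q ∷ p ∷ Y)
  there : ∀ {x Y Y'} → Swap Y Y' → Swap (x ∷ Y) (x ∷ Y')

infixr 5 _∷ʷ_
data Word : Form → Form → Set where
  nil  : ∀ {A} → Word A A
  _∷ʷ_ : ∀ {A B C} → Swap A B → Word B C → Word A C

⟦_⟧ˢ : ∀ {A B} → Swap A B → Tm A B
⟦ here {p} {q} {Y} ⟧ˢ = c [ p ] [ q ] ⊗ id Y
⟦ there {x} s ⟧ˢ = id [ x ] ⊗ ⟦ s ⟧ˢ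

⟦_⟧ʷ : ∀ {A B} → Word A B → Tm A B
⟦ nil {A} ⟧ʷ = id A
⟦ s ∷ʷ w ⟧ʷ = ⟦ w ⟧ʷ ∘ ⟦ s ⟧ˢ

infixr 5 _++ʷ_
_++ʷ_ : ∀ {A B C} → Word A B → Word B C → Word A C
nil ++ʷ w = w
(s ∷ʷ v) ++ʷ w = s ∷ʷ (v ++ʷ w)

⟦++ʷ⟧ : ∀ {A B C} (v : Word A B) (w : Word B C) → ⟦ v ++ʷ w ⟧ʷ ≈ (⟦ w ⟧ʷ ∘ ⟦ v ⟧ʷ)
⟦++ʷ⟧ nil w = ≈-sym (idʳ _)
⟦++ʷ⟧ (s ∷ʷ v) w = ∘-cong (⟦++ʷ⟧ v w) ≈-refl ⟫ ≈-sym (∘-assoc _ _ _)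

swap-whiskerˡ : ∀ X {A B} → Swap A B → Swap (X ++ A) (X ++ B)
swap-whiskerˡ [] s = s
swap-whiskerˡ (x ∷ X) s = there (swap-whiskerˡ X s)

⟦swap-whiskerˡ⟧ : ∀ X {A B} (s : Swap A B) → ⟦ swap-whiskerˡ X s ⟧ˢ ≈ (id X ⊗ ⟦ s ⟧ˢ)
⟦swap-whiskerˡ⟧ [] s = ≈-sym (⊗-unitˡ _)
⟦swap-whiskerˡ⟧ (x ∷ X) s = ⊗-cong ≈-refl (⟦swap-whiskerˡ⟧ X s) ⟫ id⊗-id⊗ [ x ] X _

swap-whiskerʳ : ∀ {A B} → Swap A B → ∀ Z → Swap (A ++ Z) (B ++ Z)
swap-whiskerʳ here Z = here
swap-whiskerʳ (there s) Z = there (swap-whiskerʳ s Z)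

⟦swap-whiskerʳ⟧ : ∀ {A B} (s : Swap A B) Z → ⟦ swap-whiskerʳ s Z ⟧ˢ ≈ (⟦ s ⟧ˢ ⊗ id Z)
⟦swap-whiskerʳ⟧ (here {Y = Y}) Z = ≈-sym (⊗id-⊗id _ Y Z)
⟦swap-whiskerʳ⟧ (there s) Z = ⊗-cong ≈-refl (⟦swap-whiskerʳ⟧ s Z) ⟫ ⊗-assoc _ _ _

whiskerˡ : ∀ X {A B} → Word A B → Word (X ++ A) (X ++ B)
whiskerˡ X nil = nil
whiskerˡ X (s ∷ʷ w) = swap-whiskerˡ X s ∷ʷ whiskerˡ X w

⟦whiskerˡ⟧ : ∀ X {A B} (w : Word A B) → ⟦ whiskerˡ X w ⟧ʷ ≈ (id X ⊗ ⟦ w ⟧ʷ)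
⟦whiskerˡ⟧ X (nil {A}) = ≈-sym (id⊗id X A)
⟦whiskerˡ⟧ X (s ∷ʷ w) =
  ∘-cong (⟦whiskerˡ⟧ X w) (⟦swap-whiskerˡ⟧ X s) ⟫ ≈-sym (id⊗-∘ X _ _)

whiskerʳ : ∀ {A B} → Word A B → ∀ Z → Word (A ++ Z) (B ++ Z)
whiskerʳ nil Z = nil
whiskerʳ (s ∷ʷ w) Z = swap-whiskerʳ s Z ∷ʷ whiskerʳ w Z

⟦whiskerʳ⟧ : ∀ {A B} (w : Word A B) Z → ⟦ whiskerʳ w Z ⟧ʷ ≈ (⟦ w ⟧ʷ ⊗ id Z)
⟦whiskerʳ⟧ (nil {A}) Z = ≈-sym (id⊗id A Z)
⟦whiskerʳ⟧ (s ∷ʷ w) Z =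
  ∘-cong (⟦whiskerʳ⟧ w Z) (⟦swap-whiskerʳ⟧ s Z) ⟫ ≈-sym (∘-⊗id Z _ _)

HasWord : ∀ {A B} → Tm A B → Set
HasWord {A} {B} f = Σ[ w ∈ Word A B ] f ≈ ⟦ w ⟧ʷ

hasWord-resp : ∀ {A B A' B'} {f : Tm A B} {g : Tm A' B'} →
               A' ≡ A → B' ≡ B → f ≈ g → HasWord g → HasWord f
hasWord-resp refl refl f≈g (w , g≈w) = w , (f≈g ⟫ g≈w)

id-hasWord : ∀ A → HasWord (id A)
id-hasWord A = nil , ≈-refl

swap-hasWord : ∀ {A B} (s : Swap A B) → HasWord ⟦ s ⟧ˢ
swap-hasWord s = s ∷ʷ nil , ≈-sym (idˡ _)

∘-hasWord : ∀ {A B C} {g : Tm B C} {f : Tm A B} → HasWord g → HasWord f → HasWord (g ∘ f)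
∘-hasWord (v , g≈v) (w , f≈w) = w ++ʷ v , (∘-cong g≈v f≈w ⟫ ≈-sym (⟦++ʷ⟧ w v))

id⊗-hasWord : ∀ X {A B} {f : Tm A B} → HasWord f → HasWord (id X ⊗ f)
id⊗-hasWord X (w , f≈w) = whiskerˡ X w , (⊗-cong ≈-refl f≈w ⟫ ≈-sym (⟦whiskerˡ⟧ X w))

⊗id-hasWord : ∀ Z {A B} {f : Tm A B} → HasWord f → HasWord (f ⊗ id Z)
⊗id-hasWord Z (w , f≈w) = whiskerʳ w Z , (⊗-cong f≈w ≈-refl ⟫ ≈-sym (⟦whiskerʳ⟧ w Z))

c₁-hasWord : ∀ x Y → HasWord (c [ x ] Y)
c₁-hasWord x [] = hasWord-resp refl refl (c-unitʳ [ x ]) (id-hasWord [ x ])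
c₁-hasWord x (y ∷ Y) =
  hasWord-resp refl refl (c-hexʳ x y Y)
    (∘-hasWord (id⊗-hasWord [ y ] (c₁-hasWord x Y)) (swap-hasWord here))

c-hasWord : ∀ X Y → HasWord (c X Y)
c-hasWord [] Y = hasWord-resp refl (sym (++-identityʳ Y)) (c-unitˡ Y) (id-hasWord Y)
c-hasWord (x ∷ X) Y =
  hasWord-resp refl (++-assoc Y [ x ] X) (c-hex [ x ] X Y)
    (∘-hasWord (⊗id-hasWord X (c₁-hasWord x Y)) (id⊗-hasWord [ x ] (c-hasWord X Y)))

central⇒hasWord : ∀ {A B} {f : Tm A B} → Central f → HasWord f
central⇒hasWord (id A) = id-hasWord A
central⇒hasWord (c B A) = c-hasWord B A
central⇒hasWord (g ∘ f) = ∘-hasWord (central⇒hasWord g) (central⇒hasWord f)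
central⇒hasWord (_⊗_ {B₁ = B₁} {A₂ = A₂} f g) =
  hasWord-resp refl refl (⊗-as-∘ˡ _ _)
    (∘-hasWord (id⊗-hasWord B₁ (central⇒hasWord g)) (⊗id-hasWord A₂ (central⇒hasWord f)))

shift : (a : Prime) (B₁ B₂ : Form) → Tm (a ∷ B₁ ++ B₂) (B₁ ++ a ∷ B₂)
shift a [] B₂ = id (a ∷ B₂)
shift a (b ∷ B₁) B₂ = (id [ b ] ⊗ shift a B₁ B₂) ∘ (c [ a ] [ b ] ⊗ id (B₁ ++ B₂))

-- t moves the factor a from position |A₁| to position |B₁|, acting on the other factors as rest.
record Peeled (a : Prime) (A₁ A₂ : Form) {B : Form} (t : Tm (A₁ ++ a ∷ A₂) B) : Set where
  constructor peeled
  field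
    B₁ B₂   : Form
    split   : B ≡ B₁ ++ a ∷ B₂
    rest    : Word (A₁ ++ A₂) (B₁ ++ B₂)
    factors : (t ∘ shift a A₁ A₂) ≈ (shift a B₁ B₂ ∘ (id [ a ] ⊗ ⟦ rest ⟧ʷ))

peeled-id⊗ : ∀ {a A₁ A₂ B} x {t : Tm (A₁ ++ a ∷ A₂) B} →
             Peeled a A₁ A₂ t → Peeled a (x ∷ A₁) A₂ (id [ x ] ⊗ t)
peeled-id⊗ {a} {A₁} {A₂} x {t} (peeled B₁ B₂ refl w t-factors) =
  peeled (x ∷ B₁) B₂ refl (whiskerˡ [ x ] w) (begin
      (id [ x ] ⊗ t) ∘ ((id [ x ] ⊗ shift a A₁ A₂) ∘ (c [ a ] [ x ] ⊗ id (A₁ ++ A₂)))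
    ≈⟨ ∘-assoc _ _ _ ⟫ ∘-cong (≈-sym (id⊗-∘ [ x ] _ _)) ≈-refl ⟩
      (id [ x ] ⊗ (t ∘ shift a A₁ A₂)) ∘ (c [ a ] [ x ] ⊗ id (A₁ ++ A₂))
    ≈⟨ ∘-cong (⊗-cong ≈-refl t-factors ⟫ id⊗-∘ [ x ] _ _) ≈-refl ⟫ ≈-sym (∘-assoc _ _ _) ⟩
      (id [ x ] ⊗ shift a B₁ B₂) ∘ ((id [ x ] ⊗ (id [ a ] ⊗ ⟦ w ⟧ʷ)) ∘ (c [ a ] [ x ] ⊗ id (A₁ ++ A₂)))
    ≈⟨ ∘-cong ≈-refl (≈-sym (c-slide a x ⟦ w ⟧ʷ)) ⟫ ∘-assoc _ _ _ ⟩
      ((id [ x ] ⊗ shift a B₁ B₂) ∘ (c [ a ] [ x ] ⊗ id (B₁ ++ B₂))) ∘ (id [ a ] ⊗ (id [ x ] ⊗ ⟦ w ⟧ʷ))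
    ≈⟨ ∘-cong ≈-refl (⊗-cong ≈-refl (≈-sym (⟦whiskerˡ⟧ [ x ] w))) ⟩
      shift a (x ∷ B₁) B₂ ∘ (id [ a ] ⊗ ⟦ whiskerˡ [ x ] w ⟧ʷ) ∎)

peel-swap : ∀ a A₁ A₂ {B} (s : Swap (A₁ ++ a ∷ A₂) B) → Peeled a A₁ A₂ ⟦ s ⟧ˢ
peel-swap a [] _ (here {q = q} {Y = Y}) = peeled [ q ] Y refl nil (begin
    (c [ a ] [ q ] ⊗ id Y) ∘ id (a ∷ q ∷ Y)
  ≈⟨ idʳ _ ⟫ ≈-sym (idˡ _) ⟫ ∘-cong (≈-sym (id⊗id [ q ] (a ∷ Y))) ≈-refl ⟩
    (id [ q ] ⊗ id (a ∷ Y)) ∘ (c [ a ] [ q ] ⊗ id Y)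
  ≈⟨ ≈-sym (idʳ _) ⟫ ∘-cong ≈-refl (≈-sym (id⊗id [ a ] (q ∷ Y))) ⟩
    ((id [ q ] ⊗ id (a ∷ Y)) ∘ (c [ a ] [ q ] ⊗ id Y)) ∘ (id [ a ] ⊗ id (q ∷ Y)) ∎)
peel-swap a [] _ (there s) =
  peeled [] _ refl (s ∷ʷ nil) (idʳ _ ⟫ ⊗-cong ≈-refl (≈-sym (idˡ _)) ⟫ ≈-sym (idˡ _))
peel-swap a (p ∷ []) A₂ here = peeled [] (p ∷ A₂) refl nil (begin
    (c [ p ] [ a ] ⊗ id A₂) ∘ ((id [ p ] ⊗ id (a ∷ A₂)) ∘ (c [ a ] [ p ] ⊗ id A₂))
  ≈⟨ ∘-cong ≈-refl (∘-cong (id⊗id [ p ] (a ∷ A₂)) ≈-refl ⟫ idˡ _) ⟩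
    (c [ p ] [ a ] ⊗ id A₂) ∘ (c [ a ] [ p ] ⊗ id A₂)
  ≈⟨ ≈-sym (∘-⊗id A₂ _ _) ⟫ ⊗-cong (c-inv [ a ] [ p ]) ≈-refl ⟫ id⊗id (a ∷ p ∷ []) A₂ ⟩
    id (a ∷ p ∷ A₂)
  ≈⟨ ≈-sym (idˡ _ ⟫ id⊗id [ a ] (p ∷ A₂)) ⟩
    id (a ∷ p ∷ A₂) ∘ (id [ a ] ⊗ id (p ∷ A₂)) ∎)
peel-swap a (p ∷ q ∷ A₁) A₂ here = peeled (q ∷ p ∷ A₁) A₂ refl (here ∷ʷ nil) (begin
    (c [ p ] [ q ] ⊗ id (A₁ ++ a ∷ A₂)) ∘
      ((id [ p ] ⊗ ((id [ q ] ⊗ shift a A₁ A₂) ∘ (c [ a ] [ q ] ⊗ id (A₁ ++ A₂)))) ∘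
       (c [ a ] [ p ] ⊗ id (q ∷ A₁ ++ A₂)))
  ≈⟨ ∘-cong ≈-refl (∘-cong (id⊗-∘ [ p ] _ _) ≈-refl ⟫ ≈-sym (∘-assoc _ _ _)) ⟫ ∘-assoc _ _ _ ⟫
     ∘-cong (c-slide p q (shift a A₁ A₂)) ≈-refl ⟫ ≈-sym (∘-assoc _ _ _) ⟩
    (id [ q ] ⊗ (id [ p ] ⊗ shift a A₁ A₂)) ∘
      ((c [ p ] [ q ] ⊗ id (a ∷ A₁ ++ A₂)) ∘
       ((id [ p ] ⊗ (c [ a ] [ q ] ⊗ id (A₁ ++ A₂))) ∘ (c [ a ] [ p ] ⊗ id (q ∷ A₁ ++ A₂))))
  ≈⟨ ∘-cong ≈-refl (c-braid-⊗id a p q (A₁ ++ A₂)) ⟩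
    (id [ q ] ⊗ (id [ p ] ⊗ shift a A₁ A₂)) ∘
      ((id [ q ] ⊗ (c [ a ] [ p ] ⊗ id (A₁ ++ A₂))) ∘
       ((c [ a ] [ q ] ⊗ id (p ∷ A₁ ++ A₂)) ∘ (id [ a ] ⊗ (c [ p ] [ q ] ⊗ id (A₁ ++ A₂)))))
  ≈⟨ ∘-assoc _ _ _ ⟫ ∘-assoc _ _ _ ⟫ ∘-cong (∘-cong (≈-sym (id⊗-∘ [ q ] _ _)) ≈-refl) ≈-refl ⟫
     ∘-cong ≈-refl (⊗-cong ≈-refl (≈-sym (idˡ _))) ⟩
    shift a (q ∷ p ∷ A₁) A₂ ∘ (id [ a ] ⊗ ⟦ here ∷ʷ nil ⟧ʷ) ∎)
peel-swap a (x ∷ A₁) A₂ (there s) = peeled-id⊗ x (peel-swap a A₁ A₂ s)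

peel-word : ∀ a A₁ A₂ {B} (w : Word (A₁ ++ a ∷ A₂) B) → Peeled a A₁ A₂ ⟦ w ⟧ʷ
peel-word a A₁ A₂ nil =
  peeled A₁ A₂ refl nil (idˡ _ ⟫ ≈-sym (idʳ _) ⟫ ∘-cong ≈-refl (≈-sym (id⊗id [ a ] (A₁ ++ A₂))))
peel-word a A₁ A₂ (s ∷ʷ w) with peel-swap a A₁ A₂ s
... | peeled B₁ B₂ refl v s-factors with peel-word a B₁ B₂ w
... | peeled C₁ C₂ split v′ w-factors = peeled C₁ C₂ split (v ++ʷ v′) (begin
    (⟦ w ⟧ʷ ∘ ⟦ s ⟧ˢ) ∘ shift a A₁ A₂
  ≈⟨ ≈-sym (∘-assoc _ _ _) ⟫ ∘-cong ≈-refl s-factors ⟫ ∘-assoc _ _ _ ⟩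
    (⟦ w ⟧ʷ ∘ shift a B₁ B₂) ∘ (id [ a ] ⊗ ⟦ v ⟧ʷ)
  ≈⟨ ∘-cong w-factors ≈-refl ⟫ ≈-sym (∘-assoc _ _ _) ⟩
    shift a C₁ C₂ ∘ ((id [ a ] ⊗ ⟦ v′ ⟧ʷ) ∘ (id [ a ] ⊗ ⟦ v ⟧ʷ))
  ≈⟨ ∘-cong ≈-refl (≈-sym (id⊗-∘ [ a ] _ _) ⟫ ⊗-cong ≈-refl (≈-sym (⟦++ʷ⟧ v v′))) ⟩
    shift a C₁ C₂ ∘ (id [ a ] ⊗ ⟦ v ++ʷ v′ ⟧ʷ) ∎)

word⇒↭ : ∀ {A B} → Word A B → A ↭ B
word⇒↭ nil = ↭-refl
word⇒↭ (s ∷ʷ w) = ↭-trans (swap⇒↭ s) (word⇒↭ w)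
  where
  swap⇒↭ : ∀ {A B} → Swap A B → A ↭ B
  swap⇒↭ (here {p} {q}) = ↭-swap p q ↭-refl
  swap⇒↭ (there {x} s) = ↭-prep x (swap⇒↭ s)

split-unique : ∀ {a : Prime} B₁ {B₂} B₁′ {B₂′} → Unique (B₁ ++ a ∷ B₂) →
               B₁ ++ a ∷ B₂ ≡ B₁′ ++ a ∷ B₂′ → B₁ ≡ B₁′ × B₂ ≡ B₂′
split-unique [] [] _ refl = refl , refl
split-unique [] (_ ∷ B₁′) u refl = ⊥-elim (Unique[x∷xs]⇒x∉xs u (∈-insert B₁′))
split-unique (_ ∷ B₁) [] u refl = ⊥-elim (Unique[x∷xs]⇒x∉xs u (∈-insert B₁))
split-unique (b ∷ B₁) (_ ∷ B₁′) (_ ∷ u) eq with ∷-injective eq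
... | refl , eq′ = map₁ (cong (b ∷_)) (split-unique B₁ B₁′ u eq′)

word-coherence : ∀ {A B} → Unique A → (v w : Word A B) → ⟦ v ⟧ʷ ≈ ⟦ w ⟧ʷ
word-coherence {[]} _ nil nil = ≈-refl
word-coherence {a ∷ A} unique-aA@(_ ∷ unique-A) v w
  with peel-word a [] A v | peel-word a [] A w
... | peeled B₁ B₂ eq v′ v-factors | peeled B₁′ B₂′ eq′ w′ w-factors
  with split-unique B₁ B₁′ (subst Unique eq (Unique-resp-↭ (↭⇒↭ₛ (word⇒↭ v)) unique-aA))
                           (trans (sym eq) eq′)
... | refl , refl =
  ≈-sym (idʳ _) ⟫ v-factors ⟫
  ∘-cong ≈-refl (⊗-cong ≈-refl (word-coherence unique-A v′ w′)) ⟫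
  ≈-sym w-factors ⟫ idʳ _

assorted-tail : ∀ {x A} → Assorted (x ∷ A) → Assorted A
assorted-tail assorted i j i≢j = assorted (suc i) (suc j) (λ eq → i≢j (suc-injective eq))

assorted-nonconstant⇒unique : ∀ {A} → Assorted A → All (λ p → ¬ ConstP p) A → Unique A
assorted-nonconstant⇒unique {[]} _ [] = []
assorted-nonconstant⇒unique {x ∷ A} assorted (x-nonconst ∷ A-nonconst) =
  All.tabulate x≢ ∷ assorted-nonconstant⇒unique (assorted-tail assorted) A-nonconst
  where
  x≢ : ∀ {y} → y ∈ A → x ≢ y
  x≢ y∈A x≡y = assorted zero (suc (index y∈A)) (λ ()) x-nonconst
                 (subst (λ p → ¬ ConstP p) x≡Aᵢ x-nonconst) x≡Aᵢ
    where
    x≡Aᵢ : x ≡ lookup A (index y∈A)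
    x≡Aᵢ = trans x≡y (lookup-index y∈A)

assorted-reduced⇒unique : ∀ {A B} {f : Tm A B} → Assorted A → Reduced f → Unique A
assorted-reduced⇒unique assorted (inj₁ (_ , nonconst)) = assorted-nonconstant⇒unique assorted nonconst
assorted-reduced⇒unique _ (inj₂ (_ , refl)) = []

proposition4p15 : ∀ {A B : Form} (f g : Tm A B) →
    AssortedTm f → Reduced f → AssortedTm g → Reduced g → f ≈ g
proposition4p15 f g (central-f , assorted) reduced-f (central-g , _) _ =
  let v , f≈v = central⇒hasWord central-f
      w , g≈w = central⇒hasWord central-g
  in f≈v ⟫ word-coherence (assorted-reduced⇒unique assorted reduced-f) v w ⟫ ≈-sym g≈w
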